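{- Let $n,m$ be integers with $1<m<n/2$ and let $G=C(n;1,m)$. For every vertex $x$ and every integer $\ell > m/2$, writing $h=\lfloor m/2\rfloor$, $$N_\ell[x] = \left(\bigcup_{j=0}^{h-1}\Big([x+(j-\ell)m-j,\, x+(j-\ell)m+j]\cup[x+(\ell-j)m-j,\, x+(\ell-j)m+j]\Big)\right) \cup \Big[x-(\ell-h)m-h,\; x+(\ell-h)m+h\Big].$$
   Context: For an integer $n$ and positive integers $s_1<\dots<s_t\le n/2$, the circulant graph $C(n;s_1,\dots,s_t)$ has vertex set $\mathbb Z_n$, with distinct vertices $x,y$ adjacent iff $x-y \equiv \pm s_i \pmod n$ for some $i$. $N_\ell[x]=\{y: d(x,y)\le \ell\}$ is the $\ell$-th closed neighbourhood of $x$. For integers $a\le b$, $[a,b]$ denotes $\{a,a+1,\dots,b\}$ reduced modulo $n$, viewed as a subset of $\mathbb Z_n$. -}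

module Defs where

open import Data.Nat as ℕ using (ℕ; zero; suc)
open import Data.Integer using (ℤ; +_; _+_; _-_; _*_; -_; _≤_)
open import Data.Integer.Divisibility using (_∣_)
open import Data.List using (List)
open import Data.List.Relation.Unary.Any using (Any)
open import Data.Product using (Σ; ∃; _×_)
open import Data.Sum using (_⊎_)
open import Relation.Nullary using (¬_)

-- Vertices of Z_n are represented by integers; two integers denote the
-- same vertex iff they are congruent mod n.  Subsets of Z_n are
-- predicates on ℤ (congruence-invariant).
_≡_[mod_] : ℤ → ℤ → ℕ → Set
a ≡ b [mod n ] = (+ n) ∣ (a - b)

Adj : (n : ℕ) → List ℕ → ℤ → ℤ → Set
Adj n ss x y =
  ¬ (x ≡ y [mod n ]) ×
  Any (λ s → ((x - y) ≡ (+ s) [mod n ]) ⊎ ((x - y) ≡ (- (+ s)) [mod n ])) ss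

data Walk (n : ℕ) (ss : List ℕ) : ℕ → ℤ → ℤ → Set where
  stay : ∀ {x y} → x ≡ y [mod n ] → Walk n ss zero x y
  step : ∀ {k x z y} → Adj n ss x z → Walk n ss k z y → Walk n ss (suc k) x y

Dist≤ : (n : ℕ) → List ℕ → ℕ → ℤ → ℤ → Set
Dist≤ n ss ℓ x y = ∃ λ k → k ℕ.≤ ℓ × Walk n ss k x y

N[_]_,_ : (n : ℕ) → List ℕ → ℕ → ℤ → ℤ → Set
(N[ n ] ss , ℓ) x y = Dist≤ n ss ℓ x y

Interval : ℕ → ℤ → ℤ → ℤ → Set
Interval n a b y = ∃ λ k → a ≤ k × k ≤ b × y ≡ k [mod n ]

-- A walk of length k from x ends at x + a m + b with |a| + |b| ≤ k, and every such point is
-- reached by |a| steps ±m followed by |b| steps ±1, so N_ℓ[x] - x is the set of offsets a m + b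
-- with |a| + |b| ≤ ℓ.  Let h = ⌊m/2⌋.  An offset with |a| ≤ ℓ - h has absolute value at most
-- (ℓ - h) m + h, and every such t is an offset: if t = q m + r with h < r < m, overshoot to
-- (q + 1) m and come back m - r ≤ h.  An offset with |a| = ℓ - j > ℓ - h lies within j of a m.
module Submission where

open import Defs
open import Data.Nat as ℕ using (ℕ; zero; suc; _/_; z≤n; s≤s)
import Data.Nat.Properties as ℕP
open import Algebra.Properties.CommutativeSemigroup ℕP.+-commutativeSemigroup using (interchange)
import Data.Nat.Divisibility as ℕD
open import Data.Nat.DivMod using (m≡m%n+[m/n]*n; m/n*n≤m; m/n<m; m%n<n)
open import Data.Integer as ℤ using (ℤ; +_; -[1+_]; _+_; _-_; _*_; -_; ∣_∣)
import Data.Integer.Properties as ℤP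
import Data.Integer.Divisibility.Signed as ℤDS
open import Data.Integer.Tactic.RingSolver using (solve-∀)
open import Data.List using (List; _∷_; [])
open import Data.List.Membership.Propositional using (_∈_)
open import Data.List.Relation.Unary.Any as Any using (here; there)
open import Data.Product using (∃; ∃₂; _×_; _,_)
open import Data.Sum using (_⊎_; inj₁; inj₂)
open import Function.Base using (_∘_)
open import Function.Bundles using (_⇔_; mk⇔; module Equivalence)
import Function.Properties.Equivalence as ⇔
open import Function.Related.Propositional using (equivalence)
import Data.Product.Function.Dependent.Propositional as Σ
open import Data.Product.Function.NonDependent.Propositional using (_×-⇔_)
open import Relation.Binary.Bundles using (Setoid)
open import Relation.Binary.Structures using (IsEquivalence)
open import Relation.Binary.PropositionalEquality
open import Relation.Nullary using (¬_; yes; no)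

module _ {n : ℕ} where

  ≡⇒≡-mod : ∀ {i j} → i ≡ j → i ≡ j [mod n ]
  ≡⇒≡-mod {i} refl = subst (n ℕD.∣_) (sym (cong ∣_∣ (ℤP.+-inverseʳ i))) (n ℕD.∣0)

  ≡-mod-sym : ∀ {i j} → i ≡ j [mod n ] → j ≡ i [mod n ]
  ≡-mod-sym {i} {j} = subst (n ℕD.∣_) (ℤP.∣i-j∣≡∣j-i∣ i j)

  ≡-mod-trans : ∀ {i j k} → i ≡ j [mod n ] → j ≡ k [mod n ] → i ≡ k [mod n ]
  ≡-mod-trans {i} {j} {k} p q = ℤDS.∣⇒∣ᵤ {+ n} {i - k}
    (subst (+ n ℤDS.∣_) (ℤP.+-minus-telescope i j k)
      (ℤDS.∣m∣n⇒∣m+n (ℤDS.∣ᵤ⇒∣ {+ n} {i - j} p) (ℤDS.∣ᵤ⇒∣ {+ n} {j - k} q)))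

  ≡-mod-+ʳ : ∀ i j k → i ≡ j [mod n ] → (i + k) ≡ (j + k) [mod n ]
  ≡-mod-+ʳ i j k = subst (λ d → n ℕD.∣ ∣ d ∣) (difference i j k)
    where
    difference : ∀ i j k → i - j ≡ (i + k) - (j + k)
    difference = solve-∀

  i-j≡k⇒j≡i-k : ∀ i j k → (i - j) ≡ k [mod n ] → j ≡ (i - k) [mod n ]
  i-j≡k⇒j≡i-k i j k = ≡-mod-sym {i - k} {j} ∘ subst (λ d → n ℕD.∣ ∣ d ∣) (rearrange i j k)
    where
    rearrange : ∀ i j k → (i - j) - k ≡ (i - k) - j
    rearrange = solve-∀

  ≡-mod-isEquivalence : IsEquivalence (λ i j → i ≡ j [mod n ])
  ≡-mod-isEquivalence = record
    { refl  = λ {i} → ≡⇒≡-mod {i} refl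
    ; sym   = λ {i j} → ≡-mod-sym {i} {j}
    ; trans = λ {i j k} → ≡-mod-trans {i} {j} {k}
    }

≡-mod-setoid : ℕ → Setoid _ _
≡-mod-setoid n = record { isEquivalence = ≡-mod-isEquivalence {n} }

Step : ℕ → List ℕ → ℤ → Set
Step n ss d = ∀ w → Adj n ss w (w + d)

module _ {n : ℕ} {ss : List ℕ} {s : ℕ} (s∈ss : s ∈ ss) (0<s : 0 ℕ.< s) (s<n : s ℕ.< n) where

  private
    w-[w+d]≡-d : ∀ w d → w - (w + d) ≡ - d
    w-[w+d]≡-d = solve-∀

    w≢w+d : ∀ w d → ∣ d ∣ ≡ s → ¬ (w ≡ (w + d) [mod n ])
    w≢w+d w d ∣d∣≡s n∣ = ℕP.<⇒≱ s<n (ℕD.∣⇒≤ {{ℕ.>-nonZero 0<s}} (subst (n ℕD.∣_) ∣w-[w+d]∣≡s n∣))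
      where
      ∣w-[w+d]∣≡s : ∣ w - (w + d) ∣ ≡ s
      ∣w-[w+d]∣≡s = trans (cong ∣_∣ (w-[w+d]≡-d w d)) (trans (ℤP.∣-i∣≡∣i∣ d) ∣d∣≡s)

  step⁺ : Step n ss (+ s)
  step⁺ w = w≢w+d w (+ s) refl ,
            Any.map (λ { refl → inj₂ (≡⇒≡-mod (w-[w+d]≡-d w (+ s))) }) s∈ss

  step⁻ : Step n ss (- + s)
  step⁻ w = w≢w+d w (- + s) (ℤP.∣-i∣≡∣i∣ (+ s)) ,
            Any.map (λ { refl → inj₁ (≡⇒≡-mod (trans (w-[w+d]≡-d w (- + s)) (ℤP.neg-involutive (+ s)))) })
                    s∈ss

module _ {n : ℕ} {ss : List ℕ} where

  walk-repeat : ∀ {d} → Step n ss d → ∀ K {r w y} →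
                Walk n ss r (w + + K * d) y → Walk n ss (K ℕ.+ r) w y
  walk-repeat move zero {w = w} {y} W = subst (λ v → Walk n ss _ v y) (ℤP.+-identityʳ w) W
  walk-repeat {d} move (suc K) {w = w} {y} W =
    step (move w) (walk-repeat move K (subst (λ v → Walk n ss _ v y) (shift w d (+ K)) W))
    where
    shift : ∀ w d k → w + (+ 1 + k) * d ≡ (w + d) + k * d
    shift = solve-∀

  signed-step : ∀ {s} → Step n ss (+ s) → Step n ss (- + s) →
                ∀ a → ∃ λ d → Step n ss d × a * + s ≡ + ∣ a ∣ * d
  signed-step {s} up down (+ A) = + s , up , refl
  signed-step {s} up down -[1+ A ] = - + s , down ,
    trans (sym (ℤP.neg-distribˡ-* (+ suc A) (+ s))) (ℤP.neg-distribʳ-* (+ suc A) (+ s))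

Reachable : ℕ → ℕ → ℤ → Set
Reachable m ℓ t = ∃₂ λ a b → ∣ a ∣ ℕ.+ ∣ b ∣ ℕ.≤ ℓ × t ≡ a * + m + b

module _ {m : ℕ} where

  reachable-0 : Reachable m 0 (+ 0)
  reachable-0 = + 0 , + 0 , z≤n , refl

  reachable-1 : Reachable m 1 (+ 1)
  reachable-1 = + 0 , + 1 , ℕP.≤-refl , refl

  reachable-m : Reachable m 1 (+ m)
  reachable-m = + 1 , + 0 , ℕP.≤-refl ,
    sym (trans (ℤP.+-identityʳ (+ 1 * + m)) (ℤP.*-identityˡ (+ m)))

  reachable-mono : ∀ {k ℓ t} → k ℕ.≤ ℓ → Reachable m k t → Reachable m ℓ t
  reachable-mono k≤ℓ (a , b , bound , t≡) = a , b , ℕP.≤-trans bound k≤ℓ , t≡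

  reachable-neg : ∀ {ℓ t} → Reachable m ℓ t → Reachable m ℓ (- t)
  reachable-neg {ℓ} {t} (a , b , bound , refl) =
    - a , - b , subst₂ (λ i j → i ℕ.+ j ℕ.≤ ℓ) (sym (ℤP.∣-i∣≡∣i∣ a)) (sym (ℤP.∣-i∣≡∣i∣ b)) bound ,
    negate a b (+ m)
    where
    negate : ∀ a b M → - (a * M + b) ≡ (- a) * M + - b
    negate = solve-∀

  reachable-+ : ∀ {k k′ t t′} → Reachable m k t → Reachable m k′ t′ → Reachable m (k ℕ.+ k′) (t + t′)
  reachable-+ {k} {k′} (a , b , bound , refl) (a′ , b′ , bound′ , refl) =
    a + a′ , b + b′ , bound″ , collect a b a′ b′ (+ m)
    where
    open ℕP.≤-Reasoning
    bound″ : ∣ a + a′ ∣ ℕ.+ ∣ b + b′ ∣ ℕ.≤ k ℕ.+ k′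
    bound″ = begin
      ∣ a + a′ ∣ ℕ.+ ∣ b + b′ ∣                 ≤⟨ ℕP.+-mono-≤ (ℤP.∣i+j∣≤∣i∣+∣j∣ a a′) (ℤP.∣i+j∣≤∣i∣+∣j∣ b b′) ⟩
      (∣ a ∣ ℕ.+ ∣ a′ ∣) ℕ.+ (∣ b ∣ ℕ.+ ∣ b′ ∣) ≡⟨ interchange (∣ a ∣) (∣ a′ ∣) (∣ b ∣) (∣ b′ ∣) ⟩
      (∣ a ∣ ℕ.+ ∣ b ∣) ℕ.+ (∣ a′ ∣ ℕ.+ ∣ b′ ∣) ≤⟨ ℕP.+-mono-≤ bound bound′ ⟩
      k ℕ.+ k′                                 ∎
    collect : ∀ a b a′ b′ M → (a * M + b) + (a′ * M + b′) ≡ (a + a′) * M + (b + b′)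
    collect = solve-∀

module _ {n m : ℕ} (0<m : 0 ℕ.< m) (m<n : m ℕ.< n) where

  open import Relation.Binary.Reasoning.Setoid (≡-mod-setoid n)

  private
    1<n : 1 ℕ.< n
    1<n = ℕP.≤-<-trans 0<m m<n

    1∈ : 1 ∈ 1 ∷ m ∷ []
    1∈ = here refl

    m∈ : m ∈ 1 ∷ m ∷ []
    m∈ = there (here refl)

  private
    offset : ∀ x z {e} → Reachable m 1 e → (x - z) ≡ e [mod n ] ⊎ (x - z) ≡ (- e) [mod n ] →
             ∃ λ d → Reachable m 1 d × z ≡ (x + d) [mod n ]
    offset x z {e} R (inj₁ p) = - e , reachable-neg R , i-j≡k⇒j≡i-k x z e p
    offset x z {e} R (inj₂ p) = - - e , reachable-neg (reachable-neg R) , i-j≡k⇒j≡i-k x z (- e) p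

  adj⇒offset : ∀ {x z} → Adj n (1 ∷ m ∷ []) x z → ∃ λ d → Reachable m 1 d × z ≡ (x + d) [mod n ]
  adj⇒offset {x} {z} (_ , here x-z≡±1) = offset x z reachable-1 x-z≡±1
  adj⇒offset {x} {z} (_ , there (here x-z≡±m)) = offset x z reachable-m x-z≡±m

  walk⇒reachable : ∀ {k x y} → Walk n (1 ∷ m ∷ []) k x y →
                   ∃ λ t → Reachable m k t × y ≡ (x + t) [mod n ]
  walk⇒reachable {x = x} {y} (stay x≡y) = + 0 , reachable-0 , (begin
    y       ≈⟨ ≡-mod-sym {i = x} {j = y} x≡y ⟩
    x       ≡⟨ sym (ℤP.+-identityʳ x) ⟩
    x + + 0 ∎)
  walk⇒reachable {x = x} {y} (step {z = z} adj W) with adj⇒offset {x} {z} adj | walk⇒reachable W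
  ... | d , d-reachable , z≡x+d | t , t-reachable , y≡z+t =
    d + t , reachable-+ d-reachable t-reachable , (begin
    y           ≈⟨ y≡z+t ⟩
    z + t       ≈⟨ ≡-mod-+ʳ z (x + d) t z≡x+d ⟩
    x + d + t   ≡⟨ ℤP.+-assoc x d t ⟩
    x + (d + t) ∎)

  reachable⇒dist≤ : ∀ {ℓ x y t} → Reachable m ℓ t → y ≡ (x + t) [mod n ] → Dist≤ n (1 ∷ m ∷ []) ℓ x y
  reachable⇒dist≤ {ℓ} {x} {y} (a , b , bound , refl) y≡x+t
    with signed-step (step⁺ m∈ 0<m m<n) (step⁻ m∈ 0<m m<n) a
       | signed-step (step⁺ 1∈ ℕP.≤-refl 1<n) (step⁻ 1∈ ℕP.≤-refl 1<n) b
  ... | d , m-step , am≡∣a∣d | e , 1-step , b≡∣b∣e =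
    ∣ a ∣ ℕ.+ (∣ b ∣ ℕ.+ 0) , length≤ℓ ,
    walk-repeat m-step ∣ a ∣ (walk-repeat 1-step ∣ b ∣ (stay end≡y))
    where
    length≤ℓ : ∣ a ∣ ℕ.+ (∣ b ∣ ℕ.+ 0) ℕ.≤ ℓ
    length≤ℓ = subst (λ k → ∣ a ∣ ℕ.+ k ℕ.≤ ℓ) (sym (ℕP.+-identityʳ ∣ b ∣)) bound
    end≡y : (x + + ∣ a ∣ * d + + ∣ b ∣ * e) ≡ y [mod n ]
    end≡y = begin
      x + + ∣ a ∣ * d + + ∣ b ∣ * e ≡⟨ ℤP.+-assoc x _ _ ⟩
      x + (+ ∣ a ∣ * d + + ∣ b ∣ * e) ≡⟨ cong₂ (λ i j → x + (i + j))
                                           (sym am≡∣a∣d) (trans (sym b≡∣b∣e) (ℤP.*-identityʳ b)) ⟩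
      x + (a * + m + b) ≈⟨ ≡-mod-sym {i = y} {j = x + (a * + m + b)} y≡x+t ⟩
      y ∎

  distance≤⇔reachable : ∀ {ℓ x y} →
    Dist≤ n (1 ∷ m ∷ []) ℓ x y ⇔ ∃ λ t → Reachable m ℓ t × y ≡ (x + t) [mod n ]
  distance≤⇔reachable = mk⇔ to (λ (t , t-reachable , y≡x+t) → reachable⇒dist≤ t-reachable y≡x+t)
    where
    to : ∀ {ℓ x y} → Dist≤ n (1 ∷ m ∷ []) ℓ x y → ∃ λ t → Reachable m ℓ t × y ≡ (x + t) [mod n ]
    to (k , k≤ℓ , W) with walk⇒reachable W
    ... | t , t-reachable , y≡x+t = t , reachable-mono k≤ℓ t-reachable , y≡x+t

infix 4 _∈[_,_] _∈[_±_]

_∈[_,_] : ℤ → ℤ → ℤ → Set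
t ∈[ lo , hi ] = lo ℤ.≤ t × t ℤ.≤ hi

_∈[_±_] : ℤ → ℤ → ℕ → Set
t ∈[ c ± j ] = t ∈[ c - + j , c + + j ]

∈[]-shift : ∀ d {i lo hi i′ lo′ hi′} → i ∈[ lo , hi ] →
            i′ ≡ i + d → lo′ ≡ lo + d → hi′ ≡ hi + d → i′ ∈[ lo′ , hi′ ]
∈[]-shift d (lo≤i , i≤hi) refl refl refl = ℤP.+-monoˡ-≤ d lo≤i , ℤP.+-monoˡ-≤ d i≤hi

∣i∣≤n⇔i∈[0±n] : ∀ {i n} → ∣ i ∣ ℕ.≤ n ⇔ i ∈[ - + n , + n ]
∣i∣≤n⇔i∈[0±n] {i} {n} = mk⇔ (to i) (from i)
  where
  to : ∀ i → ∣ i ∣ ℕ.≤ n → i ∈[ - + n , + n ]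
  to (+ I) I≤n = ℤP.neg-≤-pos , ℤ.+≤+ I≤n
  to -[1+ I ] I<n = ℤP.neg-mono-≤ (ℤ.+≤+ I<n) , ℤ.-≤+
  from : ∀ i → i ∈[ - + n , + n ] → ∣ i ∣ ℕ.≤ n
  from (+ I) (_ , I≤n) = ℤP.drop‿+≤+ I≤n
  from -[1+ I ] (-n≤-I-1 , _) = ℤP.drop‿+≤+ (ℤP.neg-cancel-≤ -n≤-I-1)

∣i-c∣≤n⇔i∈[c±n] : ∀ {i c n} → ∣ i - c ∣ ℕ.≤ n ⇔ i ∈[ c ± n ]
∣i-c∣≤n⇔i∈[c±n] {i} {c} {n} = mk⇔
  (λ ∣i-c∣≤n → ∈[]-shift c (Equivalence.to (∣i∣≤n⇔i∈[0±n] {i - c} {n}) ∣i-c∣≤n)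
                 (sym (i-c+c≡i i c)) (sym (-n+c≡c-n (+ n) c)) (ℤP.+-comm c (+ n)))
  (λ i∈[c±n] → Equivalence.from (∣i∣≤n⇔i∈[0±n] {i - c} {n})
                 (∈[]-shift (- c) i∈[c±n] refl (sym (c-n-c≡-n c (+ n))) (sym (c+n-c≡n c (+ n)))))
  where
  i-c+c≡i : ∀ i c → i - c + c ≡ i
  i-c+c≡i = solve-∀
  -n+c≡c-n : ∀ n c → - n + c ≡ c - n
  -n+c≡c-n = solve-∀
  c-n-c≡-n : ∀ c n → c - n - c ≡ - n
  c-n-c≡-n = solve-∀
  c+n-c≡n : ∀ c n → c + n - c ≡ n
  c+n-c≡n = solve-∀

pos-∸ : ∀ {m n} → n ℕ.≤ m → + m - + n ≡ + (m ℕ.∸ n)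
pos-∸ {m} {n} n≤m = trans (ℤP.m-n≡m⊖n m n) (ℤP.⊖-≥ n≤m)

∣a∣+j≡ℓ⇔a≡±[ℓ-j] : ∀ {a j ℓ} → j ℕ.≤ ℓ → ∣ a ∣ ℕ.+ j ≡ ℓ ⇔ (a ≡ + ℓ - + j ⊎ a ≡ + j - + ℓ)
∣a∣+j≡ℓ⇔a≡±[ℓ-j] {a} {j} {ℓ} j≤ℓ = mk⇔ (to a) from
  where
  ℓ∸j≡ : ∀ {A} → A ℕ.+ j ≡ ℓ → ℓ ℕ.∸ j ≡ A
  ℓ∸j≡ {A} A+j≡ℓ = trans (cong (ℕ._∸ j) (sym A+j≡ℓ)) (ℕP.m+n∸n≡m A j)
  to : ∀ a → ∣ a ∣ ℕ.+ j ≡ ℓ → a ≡ + ℓ - + j ⊎ a ≡ + j - + ℓ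
  to (+ A) A+j≡ℓ = inj₁ (sym (trans (pos-∸ j≤ℓ) (cong +_ (ℓ∸j≡ A+j≡ℓ))))
  to -[1+ A ] A+1+j≡ℓ =
    inj₂ (sym (trans (ℤP.m-n≡m⊖n j ℓ) (trans (ℤP.⊖-≤ j≤ℓ) (cong (-_ ∘ +_) (ℓ∸j≡ A+1+j≡ℓ)))))
  from : a ≡ + ℓ - + j ⊎ a ≡ + j - + ℓ → ∣ a ∣ ℕ.+ j ≡ ℓ
  from (inj₁ refl) = trans (cong (λ i → ∣ i ∣ ℕ.+ j) (pos-∸ j≤ℓ)) (ℕP.m∸n+n≡m j≤ℓ)
  from (inj₂ refl) =
    trans (cong (ℕ._+ j) (trans (cong ∣_∣ (ℤP.m-n≡m⊖n j ℓ)) (ℤP.∣⊖∣-≤ j≤ℓ))) (ℕP.m∸n+n≡m j≤ℓ)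

reachable-near : ∀ {m ℓ j t} a → ∣ a ∣ ℕ.+ j ℕ.≤ ℓ → ∣ t - a * + m ∣ ℕ.≤ j → Reachable m ℓ t
reachable-near {m} {t = t} a bound ∣t-am∣≤j =
  a , t - a * + m , ℕP.≤-trans (ℕP.+-monoʳ-≤ ∣ a ∣ ∣t-am∣≤j) bound , sym (am+[t-am]≡t a (+ m) t)
  where
  am+[t-am]≡t : ∀ a M t → a * M + (t - a * M) ≡ t
  am+[t-am]≡t = solve-∀

weighted-≤ : ∀ {m A B L h} → 0 ℕ.< m → A ℕ.≤ L → A ℕ.+ B ℕ.≤ L ℕ.+ h → A ℕ.* m ℕ.+ B ℕ.≤ L ℕ.* m ℕ.+ h
weighted-≤ {m} {A} {B} {h = h} 0<m A≤L A+B≤L+h with ℕP.m≤n⇒∃[o]m+o≡n A≤L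
... | D , refl = begin
  A ℕ.* m ℕ.+ B               ≤⟨ ℕP.+-monoʳ-≤ (A ℕ.* m) B≤Dm+h ⟩
  A ℕ.* m ℕ.+ (D ℕ.* m ℕ.+ h) ≡⟨ sym (ℕP.+-assoc (A ℕ.* m) (D ℕ.* m) h) ⟩
  A ℕ.* m ℕ.+ D ℕ.* m ℕ.+ h   ≡⟨ cong (ℕ._+ h) (sym (ℕP.*-distribʳ-+ m A D)) ⟩
  (A ℕ.+ D) ℕ.* m ℕ.+ h       ∎
  where
  open ℕP.≤-Reasoning
  B≤D+h : B ℕ.≤ D ℕ.+ h
  B≤D+h = ℕP.+-cancelˡ-≤ A B (D ℕ.+ h) (subst (A ℕ.+ B ℕ.≤_) (ℕP.+-assoc A D h) A+B≤L+h)
  B≤Dm+h : B ℕ.≤ D ℕ.* m ℕ.+ h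
  B≤Dm+h = ℕP.≤-trans B≤D+h (ℕP.+-monoˡ-≤ h (ℕP.m≤m*n D m {{ℕ.>-nonZero 0<m}}))

∣am+b∣≤Lm+h : ∀ {m L h a b} → 0 ℕ.< m → ∣ a ∣ ℕ.≤ L → ∣ a ∣ ℕ.+ ∣ b ∣ ℕ.≤ L ℕ.+ h →
              ∣ a * + m + b ∣ ℕ.≤ L ℕ.* m ℕ.+ h
∣am+b∣≤Lm+h {m} {a = a} {b} 0<m ∣a∣≤L bound =
  ℕP.≤-trans (ℤP.∣i+j∣≤∣i∣+∣j∣ (a * + m) b)
    (subst (λ k → k ℕ.+ ∣ b ∣ ℕ.≤ _) (sym (ℤP.abs-* a (+ m))) (weighted-≤ 0<m ∣a∣≤L bound))

module _ {m h : ℕ} (h<m : h ℕ.< m) (m≤2h+1 : m ℕ.≤ suc (h ℕ.+ h)) where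

  private
    instance
      m≢0 : ℕ.NonZero m
      m≢0 = ℕ.>-nonZero (ℕP.≤-<-trans z≤n h<m)

    +T≡+r+qm : ∀ T → + T ≡ + (T ℕ.% m) + + (T / m) * + m
    +T≡+r+qm T = trans (cong +_ (m≡m%n+[m/n]*n T m))
      (trans (ℤP.pos-+ (T ℕ.% m) (T / m ℕ.* m)) (cong (_+_ (+ (T ℕ.% m))) (ℤP.pos-* (T / m) m)))

    overshoot : ∀ r q B → r + q * (r + B) ≡ (+ 1 + q) * (r + B) - B
    overshoot = solve-∀

  reachable-division : ∀ {L T} → T ℕ.≤ L ℕ.* m ℕ.+ h → Reachable m (L ℕ.+ h) (+ T)
  reachable-division {L} {T} T≤Lm+h with T ℕ.% m ℕP.≤? h
  ... | yes r≤h =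
    + q , + r , ℕP.+-mono-≤ q≤L r≤h , trans (+T≡+r+qm T) (ℤP.+-comm (+ r) (+ q * + m))
    where
    q = T / m
    r = T ℕ.% m
    q≤L : q ℕ.≤ L
    q≤L = ℕP.≤-pred (ℕP.*-cancelʳ-< m q (suc L) (begin-strict
      q ℕ.* m          ≤⟨ m/n*n≤m T m ⟩
      T                ≤⟨ T≤Lm+h ⟩
      L ℕ.* m ℕ.+ h    <⟨ ℕP.+-monoʳ-< (L ℕ.* m) h<m ⟩
      L ℕ.* m ℕ.+ m    ≡⟨ ℕP.+-comm (L ℕ.* m) m ⟩
      suc L ℕ.* m      ∎))
      where open ℕP.≤-Reasoning
  ... | no r≰h = + suc q , - + (m ℕ.∸ r) , bound ,
    trans (+T≡+r+qm T)
      (subst (λ M → + r + + q * M ≡ + suc q * M - + (m ℕ.∸ r)) (sym +m≡+r+[m∸r]) (overshoot (+ r) (+ q) (+ (m ℕ.∸ r))))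
    where
    q = T / m
    r = T ℕ.% m
    T≡r+qm : T ≡ r ℕ.+ q ℕ.* m
    T≡r+qm = m≡m%n+[m/n]*n T m
    q<L : q ℕ.< L
    q<L = ℕP.*-cancelʳ-< m q L (ℕP.+-cancelʳ-< h (q ℕ.* m) (L ℕ.* m) (begin-strict
      q ℕ.* m ℕ.+ h    <⟨ ℕP.+-monoʳ-< (q ℕ.* m) (ℕP.≰⇒> r≰h) ⟩
      q ℕ.* m ℕ.+ r    ≡⟨ trans (ℕP.+-comm (q ℕ.* m) r) (sym T≡r+qm) ⟩
      T                ≤⟨ T≤Lm+h ⟩
      L ℕ.* m ℕ.+ h    ∎))
      where open ℕP.≤-Reasoning
    m∸r≤h : m ℕ.∸ r ℕ.≤ h
    m∸r≤h = ℕP.m≤n+o⇒m∸n≤o m r (ℕP.≤-trans m≤2h+1 (ℕP.+-monoˡ-≤ h (ℕP.≰⇒> r≰h)))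
    bound : ∣ + suc q ∣ ℕ.+ ∣ - + (m ℕ.∸ r) ∣ ℕ.≤ L ℕ.+ h
    bound = subst (λ k → suc q ℕ.+ k ℕ.≤ L ℕ.+ h) (sym (ℤP.∣-i∣≡∣i∣ (+ (m ℕ.∸ r))))
                  (ℕP.+-mono-≤ q<L m∸r≤h)
    +m≡+r+[m∸r] : + m ≡ + r + + (m ℕ.∸ r)
    +m≡+r+[m∸r] = trans (cong +_ (sym (ℕP.m+[n∸m]≡n (ℕP.<⇒≤ (m%n<n T m))))) (ℤP.pos-+ r (m ℕ.∸ r))

  ∣t∣≤Lm+h⇒reachable : ∀ {L t} → ∣ t ∣ ℕ.≤ L ℕ.* m ℕ.+ h → Reachable m (L ℕ.+ h) t
  ∣t∣≤Lm+h⇒reachable {t = + T} = reachable-division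
  ∣t∣≤Lm+h⇒reachable {t = -[1+ T ]} = reachable-neg ∘ reachable-division {T = suc T}

IntervalUnion : ℕ → ℕ → ℕ → ℤ → Set
IntervalUnion m ℓ h t =
  (∃ λ j → j ℕ.< h × (t ∈[ (+ j - + ℓ) * + m ± j ] ⊎ t ∈[ (+ ℓ - + j) * + m ± j ]))
  ⊎ t ∈[ - ((+ ℓ - + h) * + m) - + h , (+ ℓ - + h) * + m + + h ]

middle⇔∣t∣≤ : ∀ {m ℓ h t} → h ℕ.≤ ℓ →
  t ∈[ - ((+ ℓ - + h) * + m) - + h , (+ ℓ - + h) * + m + + h ] ⇔ ∣ t ∣ ℕ.≤ (ℓ ℕ.∸ h) ℕ.* m ℕ.+ h
middle⇔∣t∣≤ {m} {ℓ} {h} {t} h≤ℓ =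
  subst₂ (λ lo hi → t ∈[ lo , hi ] ⇔ ∣ t ∣ ℕ.≤ N) (sym -c-h≡-N) (sym c+h≡N) (⇔.sym ∣i∣≤n⇔i∈[0±n])
  where
  N = (ℓ ℕ.∸ h) ℕ.* m ℕ.+ h
  c+h≡N : (+ ℓ - + h) * + m + + h ≡ + N
  c+h≡N = begin
    (+ ℓ - + h) * + m + + h         ≡⟨ cong (λ i → i * + m + + h) (pos-∸ h≤ℓ) ⟩
    + (ℓ ℕ.∸ h) * + m + + h         ≡⟨ cong (_+ + h) (ℤP.pos-* (ℓ ℕ.∸ h) m) ⟨
    + ((ℓ ℕ.∸ h) ℕ.* m) + + h       ≡⟨ ℤP.pos-+ ((ℓ ℕ.∸ h) ℕ.* m) h ⟨
    + N                             ∎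
    where open ≡-Reasoning
  -c-h≡-N : - ((+ ℓ - + h) * + m) - + h ≡ - + N
  -c-h≡-N = trans (sym (ℤP.neg-distrib-+ ((+ ℓ - + h) * + m) (+ h))) (cong -_ c+h≡N)

reachable⇒intervalUnion : ∀ {m ℓ h t} → 0 ℕ.< m → h ℕ.≤ ℓ → Reachable m ℓ t → IntervalUnion m ℓ h t
reachable⇒intervalUnion {m} {ℓ} {h} 0<m h≤ℓ (a , b , bound , refl) with ∣ a ∣ ℕ.+ h ℕP.≤? ℓ
... | yes ∣a∣+h≤ℓ =
  inj₂ (Equivalence.from (middle⇔∣t∣≤ h≤ℓ) (∣am+b∣≤Lm+h {a = a} {b} 0<m ∣a∣≤ℓ∸h bound′))
  where
  ∣a∣≤ℓ∸h : ∣ a ∣ ℕ.≤ ℓ ℕ.∸ h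
  ∣a∣≤ℓ∸h = ℕP.m+n≤o⇒m≤o∸n ∣ a ∣ ∣a∣+h≤ℓ
  bound′ : ∣ a ∣ ℕ.+ ∣ b ∣ ℕ.≤ ℓ ℕ.∸ h ℕ.+ h
  bound′ = subst (∣ a ∣ ℕ.+ ∣ b ∣ ℕ.≤_) (sym (ℕP.m∸n+n≡m h≤ℓ)) bound
... | no ∣a∣+h≰ℓ = inj₁ (j , j<h , side (Equivalence.to (∣a∣+j≡ℓ⇔a≡±[ℓ-j] j≤ℓ) ∣a∣+j≡ℓ))
  where
  j = ℓ ℕ.∸ ∣ a ∣
  ∣a∣+j≡ℓ : ∣ a ∣ ℕ.+ j ≡ ℓ
  ∣a∣+j≡ℓ = ℕP.m+[n∸m]≡n (ℕP.m+n≤o⇒m≤o ∣ a ∣ bound)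
  j≤ℓ : j ℕ.≤ ℓ
  j≤ℓ = ℕP.m∸n≤m ℓ ∣ a ∣
  j<h : j ℕ.< h
  j<h = ℕP.≰⇒> (λ h≤j → ∣a∣+h≰ℓ (subst (∣ a ∣ ℕ.+ h ℕ.≤_) ∣a∣+j≡ℓ (ℕP.+-monoʳ-≤ ∣ a ∣ h≤j)))
  am+b∈[am±j] : a * + m + b ∈[ a * + m ± j ]
  am+b∈[am±j] = Equivalence.to ∣i-c∣≤n⇔i∈[c±n]
    (subst (ℕ._≤ j) (cong ∣_∣ (sym (am+b-am≡b a (+ m) b)))
      (ℕP.+-cancelˡ-≤ ∣ a ∣ ∣ b ∣ j (subst (∣ a ∣ ℕ.+ ∣ b ∣ ℕ.≤_) (sym ∣a∣+j≡ℓ) bound)))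
    where
    am+b-am≡b : ∀ a M b → a * M + b - a * M ≡ b
    am+b-am≡b = solve-∀
  side : a ≡ + ℓ - + j ⊎ a ≡ + j - + ℓ →
         a * + m + b ∈[ (+ j - + ℓ) * + m ± j ] ⊎ a * + m + b ∈[ (+ ℓ - + j) * + m ± j ]
  side (inj₁ a≡ℓ-j) = inj₂ (subst (λ c → a * + m + b ∈[ c * + m ± j ]) a≡ℓ-j am+b∈[am±j])
  side (inj₂ a≡j-ℓ) = inj₁ (subst (λ c → a * + m + b ∈[ c * + m ± j ]) a≡j-ℓ am+b∈[am±j])

intervalUnion⇒reachable : ∀ {m ℓ h t} → h ℕ.< m → m ℕ.≤ suc (h ℕ.+ h) → h ℕ.≤ ℓ →
                          IntervalUnion m ℓ h t → Reachable m ℓ t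
intervalUnion⇒reachable {m} {ℓ} {h} h<m m≤2h+1 h≤ℓ (inj₁ (j , j<h , t∈)) = near t∈
  where
  j≤ℓ : j ℕ.≤ ℓ
  j≤ℓ = ℕP.≤-trans (ℕP.<⇒≤ j<h) h≤ℓ
  near-side : ∀ {t} a → a ≡ + ℓ - + j ⊎ a ≡ + j - + ℓ → t ∈[ a * + m ± j ] → Reachable m ℓ t
  near-side {t} a a≡±[ℓ-j] t∈ = reachable-near a
    (ℕP.≤-reflexive (Equivalence.from (∣a∣+j≡ℓ⇔a≡±[ℓ-j] {a} j≤ℓ) a≡±[ℓ-j]))
    (Equivalence.from (∣i-c∣≤n⇔i∈[c±n] {t} {a * + m}) t∈)
  near : ∀ {t} → t ∈[ (+ j - + ℓ) * + m ± j ] ⊎ t ∈[ (+ ℓ - + j) * + m ± j ] → Reachable m ℓ t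
  near (inj₁ t∈) = near-side (+ j - + ℓ) (inj₂ refl) t∈
  near (inj₂ t∈) = near-side (+ ℓ - + j) (inj₁ refl) t∈
intervalUnion⇒reachable {m} {ℓ} {h} {t} h<m m≤2h+1 h≤ℓ (inj₂ t∈) =
  subst (λ k → Reachable m k t) (ℕP.m∸n+n≡m h≤ℓ)
    (∣t∣≤Lm+h⇒reachable h<m m≤2h+1 (Equivalence.to (middle⇔∣t∣≤ h≤ℓ) t∈))

reachable⇔intervalUnion : ∀ {m ℓ h t} → h ℕ.< m → m ℕ.≤ suc (h ℕ.+ h) → h ℕ.≤ ℓ →
                          Reachable m ℓ t ⇔ IntervalUnion m ℓ h t
reachable⇔intervalUnion h<m m≤2h+1 h≤ℓ =
  mk⇔ (reachable⇒intervalUnion (ℕP.≤-<-trans z≤n h<m) h≤ℓ) (intervalUnion⇒reachable h<m m≤2h+1 h≤ℓ)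

interval⇔translate : ∀ {n y} x c d c′ d′ →
  Interval n (x + c + d) (x + c′ + d′) y ⇔ ∃ λ t → t ∈[ c + d , c′ + d′ ] × y ≡ (x + t) [mod n ]
interval⇔translate {n} {y} x c d c′ d′ = mk⇔ to from
  where
  x+c+d-x≡c+d : ∀ x c d → c + d ≡ x + c + d - x
  x+c+d-x≡c+d = solve-∀
  x+c+d≡c+d+x : ∀ x c d → x + c + d ≡ c + d + x
  x+c+d≡c+d+x = solve-∀
  x+[k-x]≡k : ∀ x k → x + (k - x) ≡ k
  x+[k-x]≡k = solve-∀
  to : Interval n (x + c + d) (x + c′ + d′) y →
       ∃ λ t → t ∈[ c + d , c′ + d′ ] × y ≡ (x + t) [mod n ]
  to (k , lo≤k , k≤hi , y≡k) = k - x ,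
    ∈[]-shift (- x) (lo≤k , k≤hi) refl (x+c+d-x≡c+d x c d) (x+c+d-x≡c+d x c′ d′) ,
    subst (λ i → y ≡ i [mod n ]) (sym (x+[k-x]≡k x k)) y≡k
  from : (∃ λ t → t ∈[ c + d , c′ + d′ ] × y ≡ (x + t) [mod n ]) →
         Interval n (x + c + d) (x + c′ + d′) y
  from (t , t∈ , y≡x+t) with ∈[]-shift x t∈ (ℤP.+-comm x t) (x+c+d≡c+d+x x c d) (x+c+d≡c+d+x x c′ d′)
  ... | lo≤x+t , x+t≤hi = x + t , lo≤x+t , x+t≤hi , y≡x+t

Intervals : ℕ → ℕ → ℕ → ℕ → ℤ → ℤ → Set
Intervals n m ℓ h x y =
  (∃ λ j → j ℕ.< h ×
     (Interval n (x + (+ j - + ℓ) * + m - + j) (x + (+ j - + ℓ) * + m + + j) y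
      ⊎ Interval n (x + (+ ℓ - + j) * + m - + j) (x + (+ ℓ - + j) * + m + + j) y))
  ⊎ Interval n (x - (+ ℓ - + h) * + m - + h) (x + (+ ℓ - + h) * + m + + h) y

intervals⇔translate : ∀ {n m ℓ h x y} →
  Intervals n m ℓ h x y ⇔ ∃ λ t → IntervalUnion m ℓ h t × y ≡ (x + t) [mod n ]
intervals⇔translate {n} {m} {ℓ} {h} {x} {y} = mk⇔ forward backward
  where
  open Equivalence
  around : ∀ c j →
    Interval n (x + c - + j) (x + c + + j) y ⇔ ∃ λ t → t ∈[ c ± j ] × y ≡ (x + t) [mod n ]
  around c j = interval⇔translate {n} {y} x c (- + j) c (+ j)
  middle : Interval n (x - (+ ℓ - + h) * + m - + h) (x + (+ ℓ - + h) * + m + + h) y ⇔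
           ∃ λ t → t ∈[ - ((+ ℓ - + h) * + m) - + h , (+ ℓ - + h) * + m + + h ] × y ≡ (x + t) [mod n ]
  middle = interval⇔translate {n} {y} x (- ((+ ℓ - + h) * + m)) (- + h) ((+ ℓ - + h) * + m) (+ h)
  forward : Intervals n m ℓ h x y → ∃ λ t → IntervalUnion m ℓ h t × y ≡ (x + t) [mod n ]
  forward (inj₁ (j , j<h , inj₁ y∈)) with around _ j .to y∈
  ... | t , t∈ , y≡x+t = t , inj₁ (j , j<h , inj₁ t∈) , y≡x+t
  forward (inj₁ (j , j<h , inj₂ y∈)) with around _ j .to y∈
  ... | t , t∈ , y≡x+t = t , inj₁ (j , j<h , inj₂ t∈) , y≡x+t
  forward (inj₂ y∈) with middle .to y∈
  ... | t , t∈ , y≡x+t = t , inj₂ t∈ , y≡x+t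
  backward : (∃ λ t → IntervalUnion m ℓ h t × y ≡ (x + t) [mod n ]) → Intervals n m ℓ h x y
  backward (t , inj₁ (j , j<h , inj₁ t∈) , y≡x+t) =
    inj₁ (j , j<h , inj₁ (around _ j .from (t , t∈ , y≡x+t)))
  backward (t , inj₁ (j , j<h , inj₂ t∈) , y≡x+t) =
    inj₁ (j , j<h , inj₂ (around _ j .from (t , t∈ , y≡x+t)))
  backward (t , inj₂ t∈ , y≡x+t) = inj₂ (middle .from (t , t∈ , y≡x+t))

m≡m%2+[m/2+m/2] : ∀ m → m ≡ m ℕ.% 2 ℕ.+ (m / 2 ℕ.+ m / 2)
m≡m%2+[m/2+m/2] m = trans (m≡m%n+[m/n]*n m 2)
  (cong (m ℕ.% 2 ℕ.+_) (trans (ℕP.*-comm (m / 2) 2) (cong (m / 2 ℕ.+_) (ℕP.+-identityʳ (m / 2)))))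

m/2+m/2≤m : ∀ m → m / 2 ℕ.+ m / 2 ℕ.≤ m
m/2+m/2≤m m = ℕP.≤-trans (ℕP.m≤n+m _ (m ℕ.% 2)) (ℕP.≤-reflexive (sym (m≡m%2+[m/2+m/2] m)))

m≤1+[m/2+m/2] : ∀ m → m ℕ.≤ suc (m / 2 ℕ.+ m / 2)
m≤1+[m/2+m/2] m = ℕP.≤-trans (ℕP.≤-reflexive (m≡m%2+[m/2+m/2] m)) (ℕP.+-monoˡ-≤ _ (ℕP.≤-pred (m%n<n m 2)))

m<2ℓ⇒m/2<ℓ : ∀ {m ℓ} → m ℕ.< 2 ℕ.* ℓ → m / 2 ℕ.< ℓ
m<2ℓ⇒m/2<ℓ {m} {ℓ} m<2ℓ = ℕP.*-cancelˡ-< 2 (m / 2) ℓ (ℕP.≤-<-trans 2[m/2]≤m m<2ℓ)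
  where
  2[m/2]≤m : 2 ℕ.* (m / 2) ℕ.≤ m
  2[m/2]≤m = subst (ℕ._≤ m) (cong (m / 2 ℕ.+_) (sym (ℕP.+-identityʳ (m / 2)))) (m/2+m/2≤m m)

mainTheorem5 : (n m : ℕ) → 1 ℕ.< m → 2 ℕ.* m ℕ.< n →
    (x : ℤ) (ℓ : ℕ) → m ℕ.< 2 ℕ.* ℓ → (y : ℤ) →
    (N[ n ] (1 ∷ m ∷ []) , ℓ) x y
      ⇔ ((∃ λ j → j ℕ.< m / 2 ×
            (Interval n (x + ((+ j) - (+ ℓ)) * (+ m) - (+ j)) (x + ((+ j) - (+ ℓ)) * (+ m) + (+ j)) y
             ⊎ Interval n (x + ((+ ℓ) - (+ j)) * (+ m) - (+ j)) (x + ((+ ℓ) - (+ j)) * (+ m) + (+ j)) y))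
         ⊎ Interval n (x - ((+ ℓ) - (+ (m / 2))) * (+ m) - (+ (m / 2)))
                      (x + ((+ ℓ) - (+ (m / 2))) * (+ m) + (+ (m / 2))) y)
mainTheorem5 n m 1<m 2m<n x ℓ m<2ℓ y =
  ⇔.trans (distance≤⇔reachable 0<m m<n)
    (⇔.trans (Σ.congˡ {k = equivalence} (reachable⇔intervalUnion h<m m≤2h+1 h≤ℓ ×-⇔ ⇔.refl))
      (⇔.sym (intervals⇔translate {n} {m} {ℓ} {h} {x} {y})))
  where
  h = m / 2
  0<m : 0 ℕ.< m
  0<m = ℕP.<⇒≤ 1<m
  m<n : m ℕ.< n
  m<n = ℕP.≤-<-trans (ℕP.m≤m+n m (m ℕ.+ 0)) 2m<n
  h<m : h ℕ.< m
  h<m = m/n<m m 2 {{ℕ.>-nonZero 0<m}} (s≤s (s≤s z≤n))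
  m≤2h+1 : m ℕ.≤ suc (h ℕ.+ h)
  m≤2h+1 = m≤1+[m/2+m/2] m
  h≤ℓ : h ℕ.≤ ℓ
  h≤ℓ = ℕP.<⇒≤ (m<2ℓ⇒m/2<ℓ m<2ℓ)
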